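{- Let $S\subset\mathbb{F}_2^n$, let $F=F(S)=\{\mathbf{x}\in\mathbb{F}_2^n\mid\mathbf{x}+S=S\}$, let $H=\bigcap_{\mathbf{s}\in F}H_{\mathbf{s}}$, and let $S_F\subset S$ be a complete set of representatives of the classes $\{\mathbf{x}+F\mid\mathbf{x}\in S\}$ (one element of $S$ from each class). Then $B(S)\cap H=B(S_F)\cap H$.
   Context: For $\mathbf{x},\mathbf{y}\in\mathbb{F}_2^n$ the pairing is $\mathbf{x}\cdot\mathbf{y}=\sum_{i=1}^n x_iy_i\in\mathbb{F}_2$, and $H_{\mathbf{y}}=\{\mathbf{x}\in\mathbb{F}_2^n\mid \mathbf{x}\cdot\mathbf{y}=0\}$ (so $H_{\mathbf{0}}=\mathbb{F}_2^n$). For a nonzero $\mathbf{y}$, a set $S$ is $\mathbf{y}$-balanced if $\#(S\cap H_{\mathbf{y}})=\#S/2$. The balancing set $B(S)$ is the set of nonzero $\mathbf{y}$ such that $S$ is $\mathbf{y}$-balanced. For $\mathbf{v}\in\mathbb{F}_2^n$, $\mathbf{v}+S=\{\mathbf{v}+\mathbf{x}\mid\mathbf{x}\in S\}$. (In the paper $B(S)\cap H$ is called the balancing set $B(S/F)$ of the set of classes $S/F$.) -}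

module Defs where

open import Data.Bool using (Bool; true; false; _xor_; _∧_; not)
open import Data.Nat using (ℕ; zero; suc; _*_)
open import Data.List using (List; []; _∷_; map; _++_; length; filter)
open import Data.Vec using (Vec; []; _∷_; zipWith; foldr; replicate)
open import Data.Product using (Σ; _×_)
open import Relation.Binary.PropositionalEquality using (_≡_; _≢_)
open import Relation.Nullary using (¬_)
open import Data.Bool.Properties using (T?)
open import Data.Bool using (T)

-- Vectors of 𝔽₂ⁿ, with 𝔽₂ = Bool (false = 0, true = 1, xor = +, ∧ = ·).
V : ℕ → Set
V n = Vec Bool n

_⊕_ : ∀ {n} → V n → V n → V n
x ⊕ y = zipWith _xor_ x y

𝟎 : ∀ {n} → V n
𝟎 {n} = replicate n false

_·_ : ∀ {n} → V n → V n → Bool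
x · y = foldr (λ _ → Bool) _xor_ false (zipWith _∧_ x y)

Sub : ℕ → Set
Sub n = V n → Bool

_∈_ : ∀ {n} → V n → Sub n → Set
x ∈ S = S x ≡ true

allV : (n : ℕ) → List (V n)
allV zero = [] ∷ []
allV (suc n) = map (false ∷_) (allV n) ++ map (true ∷_) (allV n)

card : ∀ {n} → Sub n → ℕ
card {n} S = length (filter (λ x → T? (S x)) (allV n))

_∩_ : ∀ {n} → Sub n → Sub n → Sub n
(S ∩ R) x = S x ∧ R x

Hyp : ∀ {n} → V n → Sub n
Hyp y x = not (x · y)

-- S is y-balanced:  #(S ∩ H_y) = #S / 2   (stated as 2·#(S ∩ H_y) = #S)
Balanced : ∀ {n} → Sub n → V n → Set
Balanced S y = 2 * card (S ∩ Hyp y) ≡ card S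

InB : ∀ {n} → Sub n → V n → Set
InB S y = (y ≢ 𝟎) × Balanced S y

-- x ∈ F(S) ⇔ x + S = S  (z ∈ x + S ⇔ x + z ∈ S)
InF : ∀ {n} → Sub n → V n → Set
InF S x = ∀ z → S (x ⊕ z) ≡ S z

InHF : ∀ {n} → Sub n → V n → Set
InHF S y = ∀ s → InF S s → y ∈ Hyp s

IsRepSystem : ∀ {n} → Sub n → Sub n → Set
IsRepSystem {n} S T =
  (∀ t → t ∈ T → t ∈ S)
  × (∀ x → x ∈ S → Σ (V n) λ t → (t ∈ T) × InF S (x ⊕ t))
  × (∀ t t′ → t ∈ T → t′ ∈ T → InF S (t ⊕ t′) → t ≡ t′)

-- Each class x + F of S has exactly #F elements, and when y ∈ H every class lies on one side
-- of the hyperplane H_y. Counting S ∩ H_y class by class therefore gives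
-- #(S ∩ H_y) = #(S_F ∩ H_y) · #F, and likewise #S = #S_F · #F; cancelling #F ≥ 1 shows
-- that S is y-balanced iff S_F is.
module Submission where

open import Defs
open import Data.Nat using (ℕ)
open import Data.Product using (_×_)
open import Function.Bundles using (_⇔_)

open import Algebra.Bundles using (CommutativeRing)
import Algebra.Properties.CommutativeSemigroup as CommSemigroupProperties
open import Data.Bool using (Bool; true; false; _xor_; _∧_; not; _≟_)
open import Data.Bool.Properties
  using (T?; ∧-comm; ∧-identityʳ; ∧-distribʳ-xor; xor-assoc; xor-identityˡ; xor-identityʳ; xor-same;
         not-involutive; xor-∧-commutativeRing)
open import Data.Nat using (zero; suc; _+_; _*_; _≤_; NonZero; >-nonZero)
open import Data.Nat.Properties
  using (+-comm; +-identityʳ; *-zeroʳ; *-identityʳ; *-comm; *-assoc; *-distribˡ-+;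
         *-cancelʳ-≡; ≤-refl; ≤-trans; m≤m+n; m≤n+m; +-commutativeSemigroup; module ≤-Reasoning)
open import Data.List using (List; []; _∷_; _++_; map; length; filter)
open import Data.List.Properties using (map-++; map-∘)
open import Data.Nat.ListAction using (sum)
open import Data.Nat.ListAction.Properties using (sum-++)
open import Data.Vec using ([]; _∷_)
open import Data.Vec.Properties using (zipWith-assoc; zipWith-identityˡ; zipWith-identityʳ; ∷-injectiveʳ)
open import Data.Product using (_,_; proj₁; proj₂)
open import Function using (_∘_)
open import Function.Bundles using (mk⇔; Equivalence)
open import Relation.Binary.PropositionalEquality
open import Relation.Nullary using (Dec; yes; no; does; ¬_; contradiction)
open import Relation.Nullary.Decidable using (map′; _×-dec_; dec-true)

open CommSemigroupProperties +-commutativeSemigroup using () renaming (interchange to +-interchange)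
open CommSemigroupProperties (CommutativeRing.+-commutativeSemigroup xor-∧-commutativeRing)
  using () renaming (interchange to xor-interchange)

toℕ : Bool → ℕ
toℕ false = 0
toℕ true  = 1

sumV : ∀ n → (V n → ℕ) → ℕ
sumV zero    f = f []
sumV (suc n) f = sumV n (f ∘ (false ∷_)) + sumV n (f ∘ (true ∷_))

sumV-cong : ∀ n {f g : V n → ℕ} → (∀ x → f x ≡ g x) → sumV n f ≡ sumV n g
sumV-cong zero    f≗g = f≗g []
sumV-cong (suc n) f≗g = cong₂ _+_ (sumV-cong n (f≗g ∘ (false ∷_))) (sumV-cong n (f≗g ∘ (true ∷_)))

sumV-zero : ∀ n {f : V n → ℕ} → (∀ x → f x ≡ 0) → sumV n f ≡ 0
sumV-zero zero    f≗0 = f≗0 []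
sumV-zero (suc n) f≗0 = cong₂ _+_ (sumV-zero n (f≗0 ∘ (false ∷_))) (sumV-zero n (f≗0 ∘ (true ∷_)))

sumV-+ : ∀ n (f g : V n → ℕ) → sumV n (λ x → f x + g x) ≡ sumV n f + sumV n g
sumV-+ zero    f g = refl
sumV-+ (suc n) f g =
  trans (cong₂ _+_ (sumV-+ n (f ∘ (false ∷_)) (g ∘ (false ∷_))) (sumV-+ n (f ∘ (true ∷_)) (g ∘ (true ∷_))))
        (+-interchange (sumV n (f ∘ (false ∷_))) (sumV n (g ∘ (false ∷_))) _ _)

sumV-*ˡ : ∀ n c (f : V n → ℕ) → sumV n (λ x → c * f x) ≡ c * sumV n f
sumV-*ˡ zero    c f = refl
sumV-*ˡ (suc n) c f =
  trans (cong₂ _+_ (sumV-*ˡ n c _) (sumV-*ˡ n c _)) (sym (*-distribˡ-+ c _ _))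

sumV-*ʳ : ∀ n c (f : V n → ℕ) → sumV n (λ x → f x * c) ≡ sumV n f * c
sumV-*ʳ n c f = begin
  sumV n (λ x → f x * c) ≡⟨ sumV-cong n (λ x → *-comm (f x) c) ⟩
  sumV n (λ x → c * f x) ≡⟨ sumV-*ˡ n c f ⟩
  c * sumV n f           ≡⟨ *-comm c _ ⟩
  sumV n f * c           ∎
  where open ≡-Reasoning

sumV-swap : ∀ m n (g : V m → V n → ℕ) →
            sumV m (λ x → sumV n (g x)) ≡ sumV n (λ t → sumV m (λ x → g x t))
sumV-swap zero    n g = refl
sumV-swap (suc m) n g =
  trans (cong₂ _+_ (sumV-swap m n _) (sumV-swap m n _)) (sym (sumV-+ n _ _))

sumV-translate : ∀ n (t : V n) (f : V n → ℕ) → sumV n (λ x → f (x ⊕ t)) ≡ sumV n f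
sumV-translate zero    []          f = refl
sumV-translate (suc n) (false ∷ t) f =
  cong₂ _+_ (sumV-translate n t (f ∘ (false ∷_))) (sumV-translate n t (f ∘ (true ∷_)))
sumV-translate (suc n) (true ∷ t)  f =
  trans (cong₂ _+_ (sumV-translate n t (f ∘ (true ∷_))) (sumV-translate n t (f ∘ (false ∷_))))
        (+-comm (sumV n (f ∘ (true ∷_))) _)

sumV-delta : ∀ n {f : V n → ℕ} (t₀ : V n) → (∀ t → t ≢ t₀ → f t ≡ 0) → sumV n f ≡ f t₀
sumV-delta zero    []           _    = refl
sumV-delta (suc n) (false ∷ t₀) f≗0 = begin
  sumV n _ + sumV n _ ≡⟨ cong₂ _+_ (sumV-delta n t₀ λ t t≢t₀ → f≗0 _ (t≢t₀ ∘ ∷-injectiveʳ))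
                                   (sumV-zero n λ t → f≗0 _ λ ()) ⟩
  _ + 0               ≡⟨ +-identityʳ _ ⟩
  _                   ∎
  where open ≡-Reasoning
sumV-delta (suc n) (true ∷ t₀)  f≗0 =
  cong₂ _+_ (sumV-zero n λ t → f≗0 _ λ ()) (sumV-delta n t₀ λ t t≢t₀ → f≗0 _ (t≢t₀ ∘ ∷-injectiveʳ))

term≤sumV : ∀ n (f : V n → ℕ) x → f x ≤ sumV n f
term≤sumV zero    f []          = ≤-refl
term≤sumV (suc n) f (false ∷ x) = ≤-trans (term≤sumV n _ x) (m≤m+n _ _)
term≤sumV (suc n) f (true ∷ x)  = ≤-trans (term≤sumV n _ x) (m≤n+m _ _)

length-filter-T? : ∀ {A : Set} (p : A → Bool) (xs : List A) →
                   length (filter (T? ∘ p) xs) ≡ sum (map (toℕ ∘ p) xs)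
length-filter-T? p []       = refl
length-filter-T? p (x ∷ xs) with p x
... | true  = cong suc (length-filter-T? p xs)
... | false = length-filter-T? p xs

sum-map-allV : ∀ n (f : V n → ℕ) → sum (map f (allV n)) ≡ sumV n f
sum-map-allV zero    f = +-identityʳ (f [])
sum-map-allV (suc n) f = begin
  sum (map f (map (false ∷_) (allV n) ++ map (true ∷_) (allV n)))
    ≡⟨ cong sum (map-++ f (map (false ∷_) (allV n)) _) ⟩
  sum (map f (map (false ∷_) (allV n)) ++ map f (map (true ∷_) (allV n)))
    ≡⟨ sum-++ (map f (map (false ∷_) (allV n))) _ ⟩
  sum (map f (map (false ∷_) (allV n))) + sum (map f (map (true ∷_) (allV n)))
    ≡⟨ cong₂ _+_ (cong sum (sym (map-∘ (allV n)))) (cong sum (sym (map-∘ (allV n)))) ⟩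
  sum (map (f ∘ (false ∷_)) (allV n)) + sum (map (f ∘ (true ∷_)) (allV n))
    ≡⟨ cong₂ _+_ (sum-map-allV n _) (sum-map-allV n _) ⟩
  sumV (suc n) f ∎
  where open ≡-Reasoning

card≡sumV : ∀ {n} (A : Sub n) → card A ≡ sumV n (toℕ ∘ A)
card≡sumV {n} A = trans (length-filter-T? A (allV n)) (sum-map-allV n (toℕ ∘ A))

card-cong : ∀ {n} {A B : Sub n} → (∀ x → A x ≡ B x) → card A ≡ card B
card-cong {n} {A} {B} A≗B = begin
  card A             ≡⟨ card≡sumV A ⟩
  sumV n (toℕ ∘ A)   ≡⟨ sumV-cong n (cong toℕ ∘ A≗B) ⟩
  sumV n (toℕ ∘ B)   ≡⟨ card≡sumV B ⟨
  card B             ∎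
  where open ≡-Reasoning

∈⇒card-nonZero : ∀ {n} {A : Sub n} {x} → x ∈ A → NonZero (card A)
∈⇒card-nonZero {n} {A} {x} x∈A = >-nonZero (begin
  1                 ≡⟨ cong toℕ x∈A ⟨
  toℕ (A x)         ≤⟨ term≤sumV n (toℕ ∘ A) x ⟩
  sumV n (toℕ ∘ A)  ≡⟨ card≡sumV A ⟨
  card A            ∎)
  where open ≤-Reasoning

⊕-assoc : ∀ {n} (x y z : V n) → (x ⊕ y) ⊕ z ≡ x ⊕ (y ⊕ z)
⊕-assoc = zipWith-assoc xor-assoc

⊕-identityˡ : ∀ {n} (x : V n) → 𝟎 ⊕ x ≡ x
⊕-identityˡ = zipWith-identityˡ xor-identityˡ

⊕-identityʳ : ∀ {n} (x : V n) → x ⊕ 𝟎 ≡ x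
⊕-identityʳ = zipWith-identityʳ xor-identityʳ

⊕-self : ∀ {n} (x : V n) → x ⊕ x ≡ 𝟎
⊕-self []      = refl
⊕-self (a ∷ x) = cong₂ _∷_ (xor-same a) (⊕-self x)

x⊕y⊕y≡x : ∀ {n} (x y : V n) → (x ⊕ y) ⊕ y ≡ x
x⊕y⊕y≡x x y = begin
  (x ⊕ y) ⊕ y  ≡⟨ ⊕-assoc x y y ⟩
  x ⊕ (y ⊕ y)  ≡⟨ cong (x ⊕_) (⊕-self y) ⟩
  x ⊕ 𝟎        ≡⟨ ⊕-identityʳ x ⟩
  x            ∎
  where open ≡-Reasoning

x⊕y⊕[x⊕z]≡y⊕z : ∀ {n} (x y z : V n) → (x ⊕ y) ⊕ (x ⊕ z) ≡ y ⊕ z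
x⊕y⊕[x⊕z]≡y⊕z []      []      []      = refl
x⊕y⊕[x⊕z]≡y⊕z (a ∷ x) (b ∷ y) (c ∷ z) = cong₂ _∷_ (head a b c) (x⊕y⊕[x⊕z]≡y⊕z x y z)
  where
  head : ∀ a b c → (a xor b) xor (a xor c) ≡ b xor c
  head false b     c = refl
  head true  false c = not-involutive c
  head true  true  c = refl

·-comm : ∀ {n} (x y : V n) → x · y ≡ y · x
·-comm []      []      = refl
·-comm (a ∷ x) (b ∷ y) = cong₂ _xor_ (∧-comm a b) (·-comm x y)

·-distribʳ-⊕ : ∀ {n} (x z y : V n) → (x ⊕ z) · y ≡ (x · y) xor (z · y)
·-distribʳ-⊕ []      []      []      = refl
·-distribʳ-⊕ (a ∷ x) (b ∷ z) (c ∷ y) = begin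
  ((a xor b) ∧ c) xor ((x ⊕ z) · y)               ≡⟨ cong₂ _xor_ (∧-distribʳ-xor c a b) (·-distribʳ-⊕ x z y) ⟩
  ((a ∧ c) xor (b ∧ c)) xor ((x · y) xor (z · y)) ≡⟨ xor-interchange (a ∧ c) (b ∧ c) _ _ ⟩
  ((a ∧ c) xor (x · y)) xor ((b ∧ c) xor (z · y)) ∎
  where open ≡-Reasoning

xor≡false⇒≡ : ∀ {a b} → a xor b ≡ false → a ≡ b
xor≡false⇒≡ {false} {false} _ = refl
xor≡false⇒≡ {true}  {true}  _ = refl

∀V? : ∀ {n} {P : V n → Set} → (∀ x → Dec (P x)) → Dec (∀ x → P x)
∀V? {zero}  P? = map′ (λ p → λ { [] → p }) (λ ∀P → ∀P []) (P? [])
∀V? {suc n} P? =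
  map′ (λ (p , q) → λ { (false ∷ x) → p x ; (true ∷ x) → q x })
       (λ ∀P → ∀P ∘ (false ∷_) , ∀P ∘ (true ∷_))
       (∀V? (P? ∘ (false ∷_)) ×-dec ∀V? (P? ∘ (true ∷_)))

period? : ∀ {n} (S : Sub n) (s : V n) → Dec (InF S s)
period? S s = ∀V? (λ z → S (s ⊕ z) ≟ S z)

Periods : ∀ {n} → Sub n → Sub n
Periods S s = does (period? S s)

period-𝟎 : ∀ {n} (S : Sub n) → InF S 𝟎
period-𝟎 S z = cong S (⊕-identityˡ z)

period-⊕ : ∀ {n} (S : Sub n) {s s′ : V n} → InF S s → InF S s′ → InF S (s ⊕ s′)
period-⊕ S {s} {s′} Fs Fs′ z = trans (cong S (⊕-assoc s s′ z)) (trans (Fs (s′ ⊕ z)) (Fs′ z))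

card-Periods-nonZero : ∀ {n} (S : Sub n) → NonZero (card (Periods S))
card-Periods-nonZero S = ∈⇒card-nonZero {A = Periods S} (dec-true (period? S 𝟎) (period-𝟎 S))

PeriodInvariant : ∀ {n} → Sub n → Sub n → Set
PeriodInvariant S P = ∀ x t → InF S (x ⊕ t) → P x ≡ P t

Hyp-periodInvariant : ∀ {n} (S : Sub n) {y : V n} → InHF S y → PeriodInvariant S (Hyp y)
Hyp-periodInvariant S {y} y∈H x t Fxt = cong not (xor≡false⇒≡ (begin
  (x · y) xor (t · y)     ≡⟨ ·-distribʳ-⊕ x t y ⟨
  (x ⊕ t) · y             ≡⟨ ·-comm (x ⊕ t) y ⟩
  y · (x ⊕ t)             ≡⟨ not-involutive _ ⟨
  not (not (y · (x ⊕ t))) ≡⟨ cong not (y∈H (x ⊕ t) Fxt) ⟩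
  false                   ∎))
  where open ≡-Reasoning

module RepSystem {n : ℕ} {S T : Sub n} (rep : IsRepSystem S T) where

  private
    k : ℕ
    k = card (Periods S)

    instance
      k-nonZero : NonZero k
      k-nonZero = card-Periods-nonZero S

  rep-class⊆S : ∀ {x t} → t ∈ T → InF S (x ⊕ t) → x ∈ S
  rep-class⊆S {x} {t} t∈T Fxt = begin
    S x               ≡⟨ cong S (x⊕y⊕y≡x x t) ⟨
    S ((x ⊕ t) ⊕ t)   ≡⟨ Fxt t ⟩
    S t               ≡⟨ proj₁ rep t t∈T ⟩
    true              ∎
    where open ≡-Reasoning

  class-rep-unique : ∀ {x t t′} → t ∈ T → t′ ∈ T → InF S (x ⊕ t) → InF S (x ⊕ t′) → t ≡ t′
  class-rep-unique {x} {t} {t′} t∈T t′∈T Fxt Fxt′ =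
    proj₂ (proj₂ rep) t t′ t∈T t′∈T (subst (InF S) (x⊕y⊕[x⊕z]≡y⊕z x t t′) (period-⊕ S Fxt Fxt′))

  module _ (P : Sub n) (P-inv : PeriodInvariant S P) where

    -- weight x t counts x towards the representative t of its class
    weight : V n → V n → ℕ
    weight x t = toℕ (T t ∧ P t) * toℕ (Periods S (x ⊕ t))

    weight-zero : ∀ {x t} → ¬ (t ∈ T × InF S (x ⊕ t)) → weight x t ≡ 0
    weight-zero {x} {t} ¬rep with T t | period? S (x ⊕ t)
    ... | false | _     = refl
    ... | true  | no _  = *-zeroʳ (toℕ (P t))
    ... | true  | yes F = contradiction (refl , F) ¬rep

    weight-rep : ∀ {x t} → t ∈ T → InF S (x ⊕ t) → weight x t ≡ toℕ (P x)
    weight-rep {x} {t} t∈T Fxt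
      rewrite t∈T | dec-true (period? S (x ⊕ t)) Fxt | P-inv x t Fxt = *-identityʳ (toℕ (P t))

    sum-weight : ∀ x → toℕ (S x ∧ P x) ≡ sumV n (weight x)
    sum-weight x with S x in x∈S
    ... | false = sym (sumV-zero n λ t → weight-zero λ (t∈T , Fxt) →
                    contradiction (trans (sym x∈S) (rep-class⊆S t∈T Fxt)) λ ())
    ... | true with proj₁ (proj₂ rep) x x∈S
    ...   | t₀ , t₀∈T , Fxt₀ = sym (trans
            (sumV-delta n t₀ λ t t≢t₀ → weight-zero λ (t∈T , Fxt) →
              t≢t₀ (class-rep-unique t∈T t₀∈T Fxt Fxt₀))
            (weight-rep t₀∈T Fxt₀))

    card-∩ : card (S ∩ P) ≡ card (T ∩ P) * k
    card-∩ = begin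
      card (S ∩ P)                                      ≡⟨ card≡sumV (S ∩ P) ⟩
      sumV n (λ x → toℕ (S x ∧ P x))                    ≡⟨ sumV-cong n sum-weight ⟩
      sumV n (λ x → sumV n (weight x))                  ≡⟨ sumV-swap n n weight ⟩
      sumV n (λ t → sumV n (λ x → weight x t))          ≡⟨ sumV-cong n inner ⟩
      sumV n (λ t → toℕ (T t ∧ P t) * k)                ≡⟨ sumV-*ʳ n k (λ t → toℕ (T t ∧ P t)) ⟩
      sumV n (λ t → toℕ (T t ∧ P t)) * k                ≡⟨ cong (_* k) (card≡sumV (T ∩ P)) ⟨
      card (T ∩ P) * k                                  ∎
      where
      open ≡-Reasoning
      inner : ∀ t → sumV n (λ x → weight x t) ≡ toℕ (T t ∧ P t) * k
      inner t = begin
        sumV n (λ x → toℕ (T t ∧ P t) * toℕ (Periods S (x ⊕ t)))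
          ≡⟨ sumV-*ˡ n (toℕ (T t ∧ P t)) _ ⟩
        toℕ (T t ∧ P t) * sumV n (λ x → toℕ (Periods S (x ⊕ t)))
          ≡⟨ cong (toℕ (T t ∧ P t) *_) (trans (sumV-translate n t _) (sym (card≡sumV (Periods S)))) ⟩
        toℕ (T t ∧ P t) * k ∎

  card-rep : card S ≡ card T * k
  card-rep = begin
    card S                    ≡⟨ card-cong (λ x → sym (∧-identityʳ (S x))) ⟩
    card (S ∩ λ _ → true)     ≡⟨ card-∩ _ (λ _ _ _ → refl) ⟩
    card (T ∩ λ _ → true) * k ≡⟨ cong (_* k) (card-cong (λ x → ∧-identityʳ (T x))) ⟩
    card T * k                ∎
    where open ≡-Reasoning

  balanced⇔ : ∀ {y} → InHF S y → Balanced S y ⇔ Balanced T y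
  balanced⇔ {y} y∈H
    rewrite card-∩ (Hyp y) (Hyp-periodInvariant S y∈H) | card-rep
          | sym (*-assoc 2 (card (T ∩ Hyp y)) k)
    = mk⇔ (*-cancelʳ-≡ _ _ k) (cong (_* k))

lemma3 : (n : ℕ) (S S_F : Sub n) → IsRepSystem S S_F →
         ∀ y → (InB S y × InHF S y) ⇔ (InB S_F y × InHF S y)
lemma3 n S S_F rep y = mk⇔
  (λ ((y≢𝟎 , bal) , y∈H) → (y≢𝟎 , Equivalence.to   (balanced⇔ y∈H) bal) , y∈H)
  (λ ((y≢𝟎 , bal) , y∈H) → (y≢𝟎 , Equivalence.from (balanced⇔ y∈H) bal) , y∈H)
  where open RepSystem rep
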